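{- Let $\vec c=(c_1,\dots,c_k)$ be a composition of $n$ with $c_k>0$, let $K_1,\dots,K_{n-k+1}$ be its column intervals, and let $\alpha\in\mathfrak S_n$. Let $\Sigma_\alpha$ be the subcomplex of $\Delta_{\vec c}$ whose facets are $\sigma(\alpha\circ\gamma,\vec c)$ for $\gamma\in\mathfrak S^c_{\vec c}$. Then $\Sigma_\alpha$ is isomorphic to the join $P_{K_1}*\cdots*P_{K_{n-k+1}}$, and hence is a sphere of dimension $k-2$.
   Context: A pointed composition of $n$ is $(c_1,\dots,c_k)$ with $c_1,\dots,c_{k-1}\ge1$, $c_k\ge0$, sum $n$, ordered by $\vec c\le\vec d$ iff $\vec d$ is obtained from $\vec c$ by replacing runs of consecutive entries by their sums. An ordered set partition of $[n]$ is $(C_1,\dots,C_r)$, pairwise disjoint with union $[n]$, $C_1,\dots,C_{r-1}$ nonempty, $C_r$ possibly empty; type $(|C_1|,\dots,|C_r|)$. $\Delta_n$ is the simplicial complex with these faces ($(C_1,\dots,C_r)$ of dimension $r-2$, faces obtained by merging consecutive blocks, $([n])$ the empty face; equivalently the order complex of the poset of nonempty subsets of $[n]$, chain $S_1\subset\dots\subset S_{r-1}$ corresponding to $(S_1,S_2\setminus S_1,\dots,[n]\setminus S_{r-1})$), and $\Delta_{\vec c}=\{\tau\in\Delta_n:\vec c\le\operatorname{type}(\tau)\}$. For $\alpha=\alpha_1\cdots\alpha_n$, $\sigma(\alpha,\vec c)=(\{\alpha_j:j\in R_1\},\dots,\{\alpha_j:j\in R_k\})$ with $R_i=[c_1+\dots+c_{i-1}+1,c_1+\dots+c_i]$;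 $\alpha\circ\gamma$ is the permutation $j\mapsto\alpha_{\gamma(j)}$. The column intervals $K_1,\dots,K_{n-k+1}$ of $\vec c$ are the maximal intervals of $[n]$ such that $j$ and $j+1$ lie in the same interval iff $j\in\{c_1,c_1+c_2,\dots,c_1+\dots+c_{k-1}\}$ (they are the intervals of the complementary composition); $\mathfrak S^c_{\vec c}=\mathfrak S_{K_1}\times\cdots\times\mathfrak S_{K_{n-k+1}}\subseteq\mathfrak S_n$. For a finite set $K$, $P_K$ denotes the order complex of the poset of nonempty proper subsets of $K$ (the barycentric subdivision of the boundary of a simplex on $K$, a sphere of dimension $|K|-2$; for $|K|=1$ it is the empty complex, the $(-1)$-sphere). -}

module Defs where

open import Level using (0ℓ)
open import Data.Nat using (ℕ; zero; suc; _+_; _∸_; _≡ᵇ_; _≤ᵇ_; _<ᵇ_)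
open import Data.Bool using (Bool; true; false; _∧_; not; if_then_else_)
open import Data.Fin using (Fin; toℕ) renaming (_≟_ to _≟F_)
open import Data.Fin.Subset using (Subset; _∪_; _⊆_; _⊂_; Nonempty) renaming (⊥ to ∅)
open import Data.Fin.Permutation using (Permutation′; _⟨$⟩ʳ_; _⟨$⟩ˡ_)
open import Data.List using (List; []; _∷_; map; length; lookup)
open import Data.Bool.ListAction using (any)
open import Data.List.Membership.Propositional using () renaming (_∈_ to _∈L_)
open import Data.Vec using (tabulate)
open import Data.Product using (Σ; ∃; _×_; proj₁)
open import Data.Sum using (_⊎_)
open import Relation.Nullary using (¬_; yes; no)
open import Relation.Binary.PropositionalEquality using (_≡_; refl)

-- Abstract simplicial complexes, given by a vertex type and a predicate
-- on finite vertex sets (represented as lists, read as sets: all the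
-- face predicates below only depend on list membership).

record Complex : Set₁ where
  field
    V    : Set
    Face : List V → Set
open Complex public

-- Simplicial isomorphism: vertex maps f, g that are mutually inverse on
-- the vertex sets (vertices = v with {v} a face) and send faces to faces.
Iso : Complex → Complex → Set
Iso Δ Γ =
  Σ (V Δ → V Γ) λ f → Σ (V Γ → V Δ) λ g →
    (∀ F → Face Δ F → Face Γ (map f F)) ×
    (∀ G → Face Γ G → Face Δ (map g G)) ×
    (∀ v → Face Δ (v ∷ []) → g (f v) ≡ v) ×
    (∀ w → Face Γ (w ∷ []) → f (g w) ≡ w)

-- Join of a finite list of complexes: vertices are pairs (i , v) with v a
-- vertex of the i-th complex (disjoint union); a face is a set whose
-- restriction to each summand is a face of that summand.
restrict : ∀ {m} {W : Fin m → Set} (i : Fin m) → List (Σ (Fin m) W) → List (W i)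
restrict i [] = []
restrict i ((j Data.Product., v) ∷ F) with j ≟F i
... | yes refl = v ∷ restrict i F
... | no _ = restrict i F

Join : List Complex → Complex
Join L = record
  { V    = Σ (Fin (length L)) (λ i → V (lookup L i))
  ; Face = λ F → ∀ i → Face (lookup L i) (restrict i F)
  }

-- P_K : order complex of the poset of nonempty proper subsets of K ⊆ [n].

P : ∀ {n} → Subset n → Complex
P {n} K = record
  { V    = Subset n
  ; Face = λ F → (∀ v → v ∈L F → Nonempty v × v ⊂ K)
               × (∀ u v → u ∈L F → v ∈L F → u ⊆ v ⊎ v ⊆ u)
  }

-- Compositions.  A composition c = (c₁,…,c_k) is a List ℕ.
-- Positions of [n] are 0-indexed: Fin n, position j ↔ the number j+1.

innerSums : List ℕ → List ℕ
innerSums [] = []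
innerSums (x ∷ []) = []
innerSums (x ∷ y ∷ xs) = x ∷ map (x +_) (innerSums (y ∷ xs))

inD : List ℕ → ℕ → Bool
inD c i = any (i ≡ᵇ_) (innerSums c)

-- column index of the (1-indexed) number j+1: the number of i ∈ [1, j]
-- with i ∉ {c₁, c₁+c₂, …} (i.e. i and i+1 are in different columns).
blk : List ℕ → ℕ → ℕ
blk c zero = 0
blk c (suc j) = blk c j + (if inD c (suc j) then 0 else 1)

-- The column intervals K_t, t = 0,…,n-k  (K_{t+1} in the paper).
Kcol : ∀ {n} → List ℕ → ℕ → Subset n
Kcol c t = tabulate (λ j → blk c (toℕ j) ≡ᵇ t)

columnIntervals : (n : ℕ) → List ℕ → List (Subset n)
columnIntervals n c = Data.List.tabulate {n = n ∸ length c + 1} (λ t → Kcol c (toℕ t))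

-- γ ∈ 𝔖^c_c : γ maps every column interval to itself
InColGroup : ∀ {n} → List ℕ → Permutation′ n → Set
InColGroup c γ = ∀ j → blk c (toℕ (γ ⟨$⟩ʳ j)) ≡ blk c (toℕ j)

-- σ(β, c) as an ordered set partition (C₁,…,C_k), given β⁻¹:
-- C_i = {β_j : j ∈ R_i} = {y : β⁻¹ y ∈ R_i}.
blocksσ : ∀ {n} → (Fin n → Fin n) → ℕ → List ℕ → List (Subset n)
blocksσ inv o [] = []
blocksσ inv o (x ∷ xs) =
  tabulate (λ y → (o ≤ᵇ toℕ (inv y)) ∧ (toℕ (inv y) <ᵇ (o + x)))
  ∷ blocksσ inv (o + x) xs

-- the face of Δ_n given by an ordered set partition (C₁,…,C_r): its vertex
-- set is the chain S₁ ⊂ ⋯ ⊂ S_{r-1}, S_i = C₁ ∪ ⋯ ∪ C_i.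
chainVerts′ : ∀ {n} → Subset n → List (Subset n) → List (Subset n)
chainVerts′ acc [] = []
chainVerts′ acc (C ∷ []) = []
chainVerts′ acc (C ∷ D ∷ Cs) = (acc ∪ C) ∷ chainVerts′ (acc ∪ C) (D ∷ Cs)

chainVerts : ∀ {n} → List (Subset n) → List (Subset n)
chainVerts = chainVerts′ ∅

-- σ(α ∘ γ, c), where (α ∘ γ)(j) = α(γ(j)), so (α ∘ γ)⁻¹ y = γ⁻¹(α⁻¹ y)
σαγ : ∀ {n} → List ℕ → Permutation′ n → Permutation′ n → List (Subset n)
σαγ c α γ = blocksσ (λ y → γ ⟨$⟩ˡ (α ⟨$⟩ˡ y)) 0 c

-- Σ_α : the complex (on vertex set the nonempty subsets of [n], as a
-- subcomplex of Δ_c ⊆ Δ_n) generated by the facets σ(α∘γ, c), γ ∈ 𝔖^c_c.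
Sigma : ∀ {n} → List ℕ → Permutation′ n → Complex
Sigma {n} c α = record
  { V    = Subset n
  ; Face = λ F → ∃ λ γ → InColGroup c γ × (∀ v → v ∈L F → v ∈L chainVerts (σαγ c α γ))
  }

module Submission where

-- The join is first replaced by a flat model (FlatJoin): its vertices are
-- pairs (t , A) with A a nonempty proper subset of the column K_t, and a
-- face is a set of such pairs that is nested within each column.  The module Correspondence gives the mutually
-- inverse vertex maps
--   φ S = (t , α⁻¹S ∩ K_t),  t the last column met by α⁻¹S,
--   ψ (t , A) = α (A ∪ K_{<t}).
-- Every vertex of a facet σ(α∘γ, c), γ ∈ 𝔖^c_c, is α(T) for a set T of
-- positions ending inside some column t (EndsIn), and φ sends facets to
-- flat faces since these sets T grow along the facet.  Conversely a flat
-- face G lies in the facet of the γ sorting the positions by column and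
-- then by how many vertices of G in that column miss them.

open import Defs
open import Data.Bool using (Bool; true; false; _∧_; _∨_; not; if_then_else_; T)
open import Data.Bool.ListAction using (any)
open import Data.Bool.Properties using (∨-zeroʳ; ∧-zeroʳ)
open import Data.Empty using (⊥; ⊥-elim)
open import Data.Fin using (Fin; toℕ; fromℕ<; punchOut) renaming (_≟_ to _≟F_)
open import Data.Fin.Permutation using (Permutation′; permutation; _⟨$⟩ʳ_; _⟨$⟩ˡ_; inverseˡ; inverseʳ)
open import Data.Fin.Properties using (toℕ<n; toℕ-fromℕ<; fromℕ<-toℕ; toℕ-injective; any?; punchOut-injective; injective⇒≤)
open import Data.Fin.Subset using (Subset; _∈_; _∉_; _⊆_; _⊂_; ∣_∣; _∪_; _∩_; Nonempty) renaming (⊥ to ∅)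
open import Data.Fin.Subset.Properties using (⊆-antisym; p⊂q⇒∣p∣<∣q∣; p⊆q⇒∣p∣≤∣q∣; ∣p∣≤n; ∣⊥∣≡0; ∉⊥; ∈⊤; ∣⊤∣≡n; _∈?_; x∈p∪q⁻; x∈p∪q⁺; x∈p∩q⁻; x∈p∩q⁺)
open import Data.List using (List; []; _∷_; map; length) renaming (lookup to lookupL; tabulate to tabulateL)
open import Data.List.Membership.Propositional using () renaming (_∈_ to _∈L_)
open import Data.List.Membership.Propositional.Properties using (∈-map⁺; ∈-map⁻)
open import Data.List.Properties using (map-∘; length-map; map-id; length-tabulate)
open import Data.List.Relation.Unary.All using (All; []; _∷_)
open import Data.List.Relation.Unary.Any using (here; there)
open import Data.Nat using (ℕ; zero; suc; _+_; _∸_; _<_; _≤_; s≤s; z≤n; _≡ᵇ_; _≤ᵇ_; _<ᵇ_; _<?_; _≤?_; _⊔_)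
open import Data.Nat.ListAction using (sum)
open import Data.Nat.Properties
open import Data.Product using (Σ; ∃; _×_; _,_; proj₁; proj₂)
open import Data.Product.Relation.Binary.Lex.Strict using (×-Lex; ×-isStrictTotalOrder)
open import Data.Sum using (_⊎_; inj₁; inj₂)
open import Data.Vec using (Vec; []; _∷_; here; there; tabulate; lookup)
open import Data.Vec.Properties using (tabulate∘lookup; tabulate-cong; lookup∘tabulate; lookup-zipWith; lookup-replicate; []=⇒lookup; lookup⇒[]=)
open import Function using (_∘_)
open import Relation.Binary.Definitions using (tri<; tri≈; tri>)
open import Relation.Binary.Structures using (IsStrictTotalOrder)
open import Relation.Binary.PropositionalEquality
open import Relation.Nullary using (¬_; yes; no; Dec; does)

Iso-trans : ∀ {A B C} → Iso A B → Iso B C → Iso A C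
Iso-trans {A} {B} {C} (f , g , f-face , g-face , gf , fg) (f′ , g′ , f′-face , g′-face , g′f′ , f′g′) =
  f′ ∘ f , g ∘ g′ ,
  (λ F F∈A → subst (Face C) (sym (map-∘ F)) (f′-face _ (f-face F F∈A))) ,
  (λ G G∈C → subst (Face A) (sym (map-∘ G)) (g-face _ (g′-face G G∈C))) ,
  (λ v v∈A → trans (cong g (g′f′ (f v) (f-face _ v∈A))) (gf v v∈A)) ,
  (λ w w∈C → trans (cong f′ (fg (g′ w) (g′-face _ w∈C))) (f′g′ w w∈C))

restrict-∈⁻ : ∀ {m} {W : Fin m → Set} (i : Fin m) (F : List (Σ (Fin m) W)) {v : W i} →
              v ∈L restrict i F → (i , v) ∈L F
restrict-∈⁻ i [] ()
restrict-∈⁻ i ((j , u) ∷ F) p with j ≟F i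
restrict-∈⁻ i ((i , u) ∷ F) (here refl) | yes refl = here refl
restrict-∈⁻ i ((i , u) ∷ F) (there p) | yes refl = there (restrict-∈⁻ i F p)
... | no _ = there (restrict-∈⁻ i F p)

restrict-∈⁺ : ∀ {m} {W : Fin m → Set} (i : Fin m) (F : List (Σ (Fin m) W)) {v : W i} →
              (i , v) ∈L F → v ∈L restrict i F
restrict-∈⁺ i [] ()
restrict-∈⁺ i ((j , u) ∷ F) p with j ≟F i
restrict-∈⁺ i ((i , u) ∷ F) (here refl) | yes refl = here refl
restrict-∈⁺ i ((i , u) ∷ F) (there p) | yes refl = there (restrict-∈⁺ i F p)
restrict-∈⁺ i ((j , u) ∷ F) (here refl) | no j≢i = ⊥-elim (j≢i refl)
restrict-∈⁺ i ((j , u) ∷ F) (there p) | no _ = restrict-∈⁺ i F p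

-- This avoids the dependent vertex types of Join.

module _ {n : ℕ} where

  Comparable : Subset n → Subset n → Set
  Comparable u v = u ⊆ v ⊎ v ⊆ u

  IsChainIn : Subset n → List (Subset n) → Set
  IsChainIn K X = (∀ v → v ∈L X → Nonempty v × v ⊂ K) × (∀ u v → u ∈L X → v ∈L X → Comparable u v)

  FlatJoin : ℕ → (ℕ → Subset n) → Complex
  FlatJoin N K = record
    { V    = ℕ × Subset n
    ; Face = λ F →
        (∀ w → w ∈L F → proj₁ w < N × Nonempty (proj₂ w) × proj₂ w ⊂ K (proj₁ w))
      × (∀ w w′ → w ∈L F → w′ ∈L F → proj₁ w ≡ proj₁ w′ → Comparable (proj₂ w) (proj₂ w′))
    }

  FlatJoin-cong : ∀ N (K K′ : ℕ → Subset n) → (∀ t → t < N → K t ≡ K′ t) → Iso (FlatJoin N K) (FlatJoin N K′)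
  FlatJoin-cong N K K′ K≡K′ =
    (λ w → w) , (λ w → w) ,
    (λ F F∈ → subst (Face (FlatJoin N K′)) (sym (map-id F)) (transfer K K′ K≡K′ F F∈)) ,
    (λ F F∈ → subst (Face (FlatJoin N K)) (sym (map-id F)) (transfer K′ K (λ t t< → sym (K≡K′ t t<)) F F∈)) ,
    (λ _ _ → refl) , (λ _ _ → refl)
    where
    transfer : ∀ (K₁ K₂ : ℕ → Subset n) → (∀ t → t < N → K₁ t ≡ K₂ t) →
               ∀ F → Face (FlatJoin N K₁) F → Face (FlatJoin N K₂) F
    transfer K₁ K₂ K₁≡K₂ F (vertex , nested) =
      (λ w w∈ → let (t< , ne , A⊂) = vertex w w∈
                in t< , ne , subst (proj₂ w ⊂_) (K₁≡K₂ (proj₁ w) t<) A⊂) ,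
      nested

  -- the t-th entry of a list of subsets (∅ past its end)
  at : List (Subset n) → ℕ → Subset n
  at [] t = ∅
  at (K ∷ L) zero = K
  at (K ∷ L) (suc t) = at L t

  at-tabulate : ∀ m (K : ℕ → Subset n) t → t < m → at (tabulateL {n = m} (λ i → K (toℕ i))) t ≡ K t
  at-tabulate (suc m) K zero _ = refl
  at-tabulate (suc m) K (suc t) (s≤s t<m) = at-tabulate m (λ i → K (suc i)) t t<m

  -- A vertex of the i-th summand of Join (map P L) is a subset of [n];
  -- these transport between the two types (the first is not a
  -- definitional equality since i is a variable).
  fromSummand : (L : List (Subset n)) (i : Fin (length (map P L))) → V (lookupL (map P L) i) → Subset n
  fromSummand (K ∷ L) Fin.zero v = v
  fromSummand (K ∷ L) (Fin.suc i) v = fromSummand L i v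

  toSummand : (L : List (Subset n)) (i : Fin (length (map P L))) → Subset n → V (lookupL (map P L) i)
  toSummand (K ∷ L) Fin.zero v = v
  toSummand (K ∷ L) (Fin.suc i) v = toSummand L i v

  from-toSummand : ∀ L i v → fromSummand L i (toSummand L i v) ≡ v
  from-toSummand (K ∷ L) Fin.zero v = refl
  from-toSummand (K ∷ L) (Fin.suc i) v = from-toSummand L i v

  to-fromSummand : ∀ L i v → toSummand L i (fromSummand L i v) ≡ v
  to-fromSummand (K ∷ L) Fin.zero v = refl
  to-fromSummand (K ∷ L) (Fin.suc i) v = to-fromSummand L i v

  summandFace⁻ : ∀ L i X → Face (lookupL (map P L) i) X → IsChainIn (at L (toℕ i)) (map (fromSummand L i) X)
  summandFace⁻ (K ∷ L) Fin.zero X X∈ rewrite map-id X = X∈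
  summandFace⁻ (K ∷ L) (Fin.suc i) X X∈ = summandFace⁻ L i X X∈

  summandFace⁺ : ∀ L i X → IsChainIn (at L (toℕ i)) (map (fromSummand L i) X) → Face (lookupL (map P L) i) X
  summandFace⁺ (K ∷ L) Fin.zero X X∈ rewrite map-id X = X∈
  summandFace⁺ (K ∷ L) (Fin.suc i) X X∈ = summandFace⁺ L i X X∈

  flatten : (L : List (Subset n)) → V (Join (map P L)) → ℕ × Subset n
  flatten L (i , v) = toℕ i , fromSummand L i v

  unflatten : (K : Subset n) (L : List (Subset n)) → ℕ × Subset n → V (Join (map P (K ∷ L)))
  unflatten K L (t , A) with t <? length (map P (K ∷ L))
  ... | yes t< = fromℕ< t< , toSummand (K ∷ L) (fromℕ< t<) A
  ... | no _ = Fin.zero , A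

  flatten-unflatten : ∀ K L t A → t < length (K ∷ L) → flatten (K ∷ L) (unflatten K L (t , A)) ≡ (t , A)
  flatten-unflatten K L t A t<len with t <? length (map P (K ∷ L))
  ... | yes t< = cong₂ _,_ (toℕ-fromℕ< t<) (from-toSummand (K ∷ L) (fromℕ< t<) A)
  ... | no t≮ = ⊥-elim (t≮ (subst (t <_) (sym (length-map P (K ∷ L))) t<len))

  unflatten-flatten : ∀ K L w → unflatten K L (flatten (K ∷ L) w) ≡ w
  unflatten-flatten K L (i , v) with toℕ i <? length (map P (K ∷ L))
  ... | yes i< = aux (fromℕ< i<) (fromℕ<-toℕ i i<)
    where
    aux : ∀ j → j ≡ i → (j , toSummand (K ∷ L) j (fromSummand (K ∷ L) i v)) ≡ (i , v)
    aux j refl = cong (i ,_) (to-fromSummand (K ∷ L) i v)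
  ... | no i≮ = ⊥-elim (i≮ (toℕ<n i))

  flatten-∈ : ∀ L (G : List (V (Join (map P L)))) i A →
              A ∈L map (fromSummand L i) (restrict i G) → (toℕ i , A) ∈L map (flatten L) G
  flatten-∈ L G i A A∈ with ∈-map⁻ (fromSummand L i) A∈
  ... | u , u∈ , refl = ∈-map⁺ (flatten L) (restrict-∈⁻ i G u∈)

  flatten-face : ∀ L G → Face (Join (map P L)) G → Face (FlatJoin (length L) (at L)) (map (flatten L) G)
  flatten-face L G G∈ = vertex , nested
    where
    vertex : ∀ w → w ∈L map (flatten L) G → proj₁ w < length L × Nonempty (proj₂ w) × proj₂ w ⊂ at L (proj₁ w)
    vertex w w∈ with ∈-map⁻ (flatten L) w∈
    ... | (j , u) , ju∈ , refl =
      subst (toℕ j <_) (length-map P L) (toℕ<n j) ,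
      proj₁ (summandFace⁻ L j _ (G∈ j)) (fromSummand L j u) (∈-map⁺ (fromSummand L j) (restrict-∈⁺ j G ju∈))
    nested : ∀ w w′ → w ∈L map (flatten L) G → w′ ∈L map (flatten L) G → proj₁ w ≡ proj₁ w′ →
             Comparable (proj₂ w) (proj₂ w′)
    nested w w′ w∈ w′∈ eq with ∈-map⁻ (flatten L) w∈ | ∈-map⁻ (flatten L) w′∈
    ... | (j , u) , ju∈ , refl | (j′ , u′) , ju∈′ , refl with toℕ-injective eq
    ... | refl = proj₂ (summandFace⁻ L j _ (G∈ j)) _ _
                   (∈-map⁺ (fromSummand L j) (restrict-∈⁺ j G ju∈))
                   (∈-map⁺ (fromSummand L j) (restrict-∈⁺ j G ju∈′))

  unflatten-face : ∀ L G → Face (FlatJoin (length L) (at L)) (map (flatten L) G) → Face (Join (map P L)) G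
  unflatten-face L G (vertex , nested) i = summandFace⁺ L i _
    ( (λ v v∈ → proj₂ (vertex _ (flatten-∈ L G i v v∈)))
    , (λ u v u∈ v∈ → nested _ _ (flatten-∈ L G i u u∈) (flatten-∈ L G i v v∈) refl))

  flat≅join : ∀ K L → Iso (FlatJoin (length (K ∷ L)) (at (K ∷ L))) (Join (map P (K ∷ L)))
  flat≅join K L =
    unflatten K L , flatten (K ∷ L) ,
    (λ F F∈ → unflatten-face (K ∷ L) _ (subst (Face flat) (sym (round-trip F F∈)) F∈)) ,
    flatten-face (K ∷ L) ,
    (λ w w∈ → flatten-unflatten K L (proj₁ w) (proj₂ w) (proj₁ (proj₁ w∈ w (here refl)))) ,
    (λ w _ → unflatten-flatten K L w)
    where
    flat : Complex
    flat = FlatJoin (length (K ∷ L)) (at (K ∷ L))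
    round-trip : ∀ F → Face flat F → map (flatten (K ∷ L)) (map (unflatten K L) F) ≡ F
    round-trip F (vertex , _) = trans (sym (map-∘ F)) (go F (λ w w∈ → w∈))
      where
      go : ∀ F′ → (∀ w → w ∈L F′ → w ∈L F) → map (flatten (K ∷ L) ∘ unflatten K L) F′ ≡ F′
      go [] _ = refl
      go ((t , A) ∷ F′) F′⊆F = cong₂ _∷_
        (flatten-unflatten K L t A (proj₁ (vertex _ (F′⊆F _ (here refl)))))
        (go F′ (λ w w∈ → F′⊆F w (there w∈)))

  flat≅join-tabulate : ∀ m (K : ℕ → Subset n) → 0 < m →
                       Iso (FlatJoin m K) (Join (map P (tabulateL {n = m} (λ t → K (toℕ t)))))
  flat≅join-tabulate (suc m) K _ =
    Iso-trans (subst (λ N → Iso (FlatJoin (suc m) K) (FlatJoin N (at L))) (sym (length-tabulate {n = suc m} (λ t → K (toℕ t))))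
                     (FlatJoin-cong (suc m) K (at L) (λ t t< → sym (at-tabulate (suc m) K t t<))))
              (flat≅join (K 0) (tabulateL {n = m} (λ t → K (suc (toℕ t)))))
    where
    L : List (Subset n)
    L = tabulateL {n = suc m} (λ t → K (toℕ t))

<ᵇ-true : ∀ {m n} → m < n → (m <ᵇ n) ≡ true
<ᵇ-true {m} {n} m<n with m <ᵇ n | <⇒<ᵇ m<n
... | true | _ = refl

<ᵇ-sound : ∀ {m n} → (m <ᵇ n) ≡ true → m < n
<ᵇ-sound {m} {n} eq = <ᵇ⇒< m n (subst T (sym eq) _)

<ᵇ-false : ∀ {m n} → ¬ (m < n) → (m <ᵇ n) ≡ false
<ᵇ-false {m} {n} m≮n with m <ᵇ n in eq
... | false = refl
... | true = ⊥-elim (m≮n (<ᵇ-sound eq))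

≤ᵇ-true : ∀ {m n} → m ≤ n → (m ≤ᵇ n) ≡ true
≤ᵇ-true {m} {n} m≤n with m ≤ᵇ n | ≤⇒≤ᵇ m≤n
... | true | _ = refl

≡ᵇ-true : ∀ {m n} → m ≡ n → (m ≡ᵇ n) ≡ true
≡ᵇ-true {m} {n} m≡n with m ≡ᵇ n | ≡⇒≡ᵇ m n m≡n
... | true | _ = refl

≡ᵇ-sound : ∀ {m n} → (m ≡ᵇ n) ≡ true → m ≡ n
≡ᵇ-sound {m} {n} eq = ≡ᵇ⇒≡ m n (subst T (sym eq) _)

≡ᵇ-false : ∀ {m n} → m ≢ n → (m ≡ᵇ n) ≡ false
≡ᵇ-false {m} {n} m≢n with m ≡ᵇ n in eq
... | false = refl
... | true = ⊥-elim (m≢n (≡ᵇ-sound eq))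

∧-true : ∀ {a b} → (a ∧ b) ≡ true → a ≡ true × b ≡ true
∧-true {true} {true} _ = refl , refl

not-true : ∀ {a} → not a ≡ true → a ≡ true → ⊥
not-true {false} _ ()

same-upperBounds⇒≡ : ∀ {a b} → (∀ s → a < s → b < s) → (∀ s → b < s → a < s) → a ≡ b
same-upperBounds⇒≡ {a} {b} a⇒b b⇒a = ≤-antisym (≤-pred (b⇒a (suc b) ≤-refl)) (≤-pred (a⇒b (suc a) ≤-refl))

vec-ext : ∀ {A : Set} {n} (u v : Vec A n) → (∀ i → lookup u i ≡ lookup v i) → u ≡ v
vec-ext u v u≗v = trans (sym (tabulate∘lookup u)) (trans (tabulate-cong u≗v) (tabulate∘lookup v))

∈⇒true : ∀ {n} {x : Fin n} {S} → x ∈ S → lookup S x ≡ true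
∈⇒true = []=⇒lookup

true⇒∈ : ∀ {n} {x : Fin n} {S} → lookup S x ≡ true → x ∈ S
true⇒∈ {x = x} {S} = lookup⇒[]= x S

∉⇒false : ∀ {n} {S : Subset n} {x} → x ∉ S → lookup S x ≡ false
∉⇒false {S = S} {x} x∉ with lookup S x in eq
... | false = refl
... | true = ⊥-elim (x∉ (true⇒∈ eq))

∩-monoˡ : ∀ {n} {A A′ K : Subset n} → A ⊆ A′ → (A ∩ K) ⊆ (A′ ∩ K)
∩-monoˡ {A = A} {K = K} A⊆A′ x∈ = x∈p∩q⁺ (A⊆A′ (proj₁ (x∈p∩q⁻ A K x∈)) , proj₂ (x∈p∩q⁻ A K x∈))

∈tabulate⁻ : ∀ {n} (f : Fin n → Bool) {x} → x ∈ tabulate f → f x ≡ true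
∈tabulate⁻ f {x} x∈ = trans (sym (lookup∘tabulate f x)) (∈⇒true x∈)

∈tabulate⁺ : ∀ {n} (f : Fin n → Bool) {x} → f x ≡ true → x ∈ tabulate f
∈tabulate⁺ f {x} fx = true⇒∈ (trans (lookup∘tabulate f x) fx)

∣∪∣-disjoint : ∀ {n} (A B : Subset n) → (∀ {x} → x ∈ A → x ∉ B) → ∣ A ∪ B ∣ ≡ ∣ A ∣ + ∣ B ∣
∣∪∣-disjoint [] [] _ = refl
∣∪∣-disjoint (true ∷ A) (true ∷ B) disj = ⊥-elim (disj here here)
∣∪∣-disjoint (true ∷ A) (false ∷ B) disj = cong suc (∣∪∣-disjoint A B (λ x∈A x∈B → disj (there x∈A) (there x∈B)))
∣∪∣-disjoint (false ∷ A) (true ∷ B) disj =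
  trans (cong suc (∣∪∣-disjoint A B (λ x∈A x∈B → disj (there x∈A) (there x∈B)))) (sym (+-suc _ _))
∣∪∣-disjoint (false ∷ A) (false ∷ B) disj = ∣∪∣-disjoint A B (λ x∈A x∈B → disj (there x∈A) (there x∈B))

DownClosed : (ℕ → Bool) → Set
DownClosed h = ∀ i → h (suc i) ≡ true → h i ≡ true

downClosed-zero : ∀ h → DownClosed h → ∀ i → h i ≡ true → h 0 ≡ true
downClosed-zero h down zero hi = hi
downClosed-zero h down (suc i) hi = downClosed-zero h down i (down i hi)

initialSegment : ∀ n (h : ℕ → Bool) → DownClosed h → ∀ j → j < n →
                 (j < ∣ tabulate {n = n} (h ∘ toℕ) ∣ → h j ≡ true) × (h j ≡ true → j < ∣ tabulate {n = n} (h ∘ toℕ) ∣)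
initialSegment (suc n) h down j j<n with h 0 in h0
... | false = (λ j< → ⊥-elim (h-false (suc j) (proj₁ (rest j (<-≤-trans j< (∣p∣≤n tail))) j<))) ,
              (λ hj → ⊥-elim (h-false j hj))
  where
  tail : Subset n
  tail = tabulate (h ∘ suc ∘ toℕ)
  rest : ∀ j → j < n → (j < ∣ tail ∣ → h (suc j) ≡ true) × (h (suc j) ≡ true → j < ∣ tail ∣)
  rest = initialSegment n (h ∘ suc) (down ∘ suc)
  h-false : ∀ i → h i ≡ true → ⊥
  h-false i hi with trans (sym h0) (downClosed-zero h down i hi)
  ... | ()
... | true = shifted j j<n
  where
  tail : Subset n
  tail = tabulate (h ∘ suc ∘ toℕ)
  shifted : ∀ j → j < suc n → (j < suc ∣ tail ∣ → h j ≡ true) × (h j ≡ true → j < suc ∣ tail ∣)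
  shifted zero _ = (λ _ → h0) , (λ _ → s≤s z≤n)
  shifted (suc j) (s≤s j<n) = (λ { (s≤s j<) → proj₁ rest j< }) , (λ hj → s≤s (proj₂ rest hj))
    where rest = initialSegment n (h ∘ suc) (down ∘ suc) j j<n

blk-step : ∀ c j → blk c j ≤ blk c (suc j)
blk-step c j = m≤m+n _ _

blk-mono : ∀ c {i j} → i ≤ j → blk c i ≤ blk c j
blk-mono c {i} {zero} z≤n = ≤-refl
blk-mono c {i} {suc j} i≤1+j with m≤n⇒m<n∨m≡n i≤1+j
... | inj₁ (s≤s i≤j) = ≤-trans (blk-mono c i≤j) (blk-step c j)
... | inj₂ refl = ≤-refl

any-≡ᵇ⇒∈ : ∀ p l → any (p ≡ᵇ_) l ≡ true → p ∈L l
any-≡ᵇ⇒∈ p (a ∷ l) e with p ≡ᵇ a in eq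
... | true = here (≡ᵇ-sound eq)
... | false = there (any-≡ᵇ⇒∈ p l e)

∈⇒any-≡ᵇ : ∀ p l → p ∈L l → any (p ≡ᵇ_) l ≡ true
∈⇒any-≡ᵇ p (a ∷ l) (here refl) rewrite ≡ᵇ-true {p} {p} refl = refl
∈⇒any-≡ᵇ p (a ∷ l) (there p∈) rewrite ∈⇒any-≡ᵇ p l p∈ = ∨-zeroʳ _

sameColumn⇒innerSum : ∀ c j → blk c (suc j) ≡ blk c j → suc j ∈L innerSums c
sameColumn⇒innerSum c j eq with inD c (suc j) in inDj
... | true = any-≡ᵇ⇒∈ (suc j) (innerSums c) inDj
... | false = ⊥-elim (m+1+n≢m (blk c j) eq)

innerSum⇒sameColumn : ∀ c j → suc j ∈L innerSums c → blk c (suc j) ≡ blk c j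
innerSum⇒sameColumn c j j∈ rewrite ∈⇒any-≡ᵇ (suc j) (innerSums c) j∈ = +-identityʳ _

innerSum-bounds : ∀ c p → All (1 ≤_) c → p ∈L innerSums c → 1 ≤ p × p < sum c
innerSum-bounds (x ∷ y ∷ xs) p (x≥1 ∷ y≥1 ∷ _) (here refl) = x≥1 , m<m+n x (≤-trans y≥1 (m≤m+n y (sum xs)))
innerSum-bounds (x ∷ c@(y ∷ xs)) p (x≥1 ∷ c≥1) (there p∈) with ∈-map⁻ (x +_) p∈
... | q , q∈ , refl = ≤-trans (proj₁ ih) (m≤n+m q x) , +-monoʳ-< x (proj₂ ih)
  where ih : 1 ≤ q × q < sum c
        ih = innerSum-bounds c q c≥1 q∈

length≤sum : ∀ c → All (1 ≤_) c → length c ≤ sum c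
length≤sum [] [] = z≤n
length≤sum (x ∷ c) (x≥1 ∷ c≥1) = +-mono-≤ x≥1 (length≤sum c c≥1)

blk-single : ∀ x j → blk (x ∷ []) j ≡ j
blk-single x zero = refl
blk-single x (suc j) = trans (cong (_+ 1) (blk-single x j)) (+-comm j 1)

any-shift : ∀ a j l → any (a + j ≡ᵇ_) (map (a +_) l) ≡ any (j ≡ᵇ_) l
any-shift a j [] = refl
any-shift a j (m ∷ l) = cong₂ _∨_ (shift a) (any-shift a j l)
  where
  shift : ∀ a → (a + j ≡ᵇ a + m) ≡ (j ≡ᵇ m)
  shift zero = refl
  shift (suc a) = shift a

any-below : ∀ a i l → i < a → any (i ≡ᵇ_) (map (a +_) l) ≡ false
any-below a i [] _ = refl
any-below a i (m ∷ l) i<a =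
  cong₂ _∨_ (≡ᵇ-false (λ i≡ → <⇒≱ i<a (subst (a ≤_) (sym i≡) (m≤m+n a m)))) (any-below a i l i<a)

module FirstPart (x′ y : ℕ) (xs : List ℕ) where
  c c′ : List ℕ
  c = suc x′ ∷ y ∷ xs
  c′ = y ∷ xs

  blk-firstPart : ∀ j → j ≤ x′ → blk c j ≡ j
  blk-firstPart zero _ = refl
  blk-firstPart (suc j) j<x′ =
    trans (cong₂ _+_ (blk-firstPart j (≤-trans (n≤1+n j) j<x′)) new-column) (+-comm j 1)
    where
    new-column : (if inD c (suc j) then 0 else 1) ≡ 1
    new-column rewrite ≡ᵇ-false {suc j} {suc x′} (<⇒≢ (s≤s j<x′))
                     | any-below (suc x′) (suc j) (innerSums c′) (s≤s j<x′) = refl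

  blk-rest : ∀ j → blk c (suc (x′ + j)) ≡ x′ + blk c′ j
  blk-rest zero rewrite +-identityʳ x′ = trans (cong₂ _+_ (blk-firstPart x′ ≤-refl) same-column) (+-identityʳ x′)
    where
    same-column : (if inD c (suc x′) then 0 else 1) ≡ 0
    same-column rewrite ≡ᵇ-true {x′} {x′} refl = refl
  blk-rest (suc j) = begin
      blk c (suc (x′ + suc j))
    ≡⟨ cong (blk c ∘ suc) (+-suc x′ j) ⟩
      blk c (suc (x′ + j)) + (if inD c (suc (suc (x′ + j))) then 0 else 1)
    ≡⟨ cong₂ _+_ (blk-rest j) (cong (λ b → if b then 0 else 1) shifted-test) ⟩
      x′ + blk c′ j + (if inD c′ (suc j) then 0 else 1)
    ≡⟨ +-assoc x′ _ _ ⟩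
      x′ + blk c′ (suc j) ∎
    where
    open ≡-Reasoning
    shifted-test : inD c (suc (suc (x′ + j))) ≡ inD c′ (suc j)
    shifted-test = cong₂ _∨_ (≡ᵇ-false (λ e → <⇒≢ (s≤s (m≤m+n x′ j)) (sym (suc-injective e))))
                             (trans (cong (λ z → any (suc z ≡ᵇ_) (map (suc x′ +_) (innerSums c′))) (sym (+-suc x′ j)))
                                    (any-shift (suc x′) (suc j) (innerSums c′)))

blk-bound : ∀ c → All (1 ≤_) c → 0 < length c → ∀ j → j < sum c → blk c j < sum c ∸ length c + 1
blk-bound (x ∷ []) (x≥1 ∷ []) _ j j< rewrite blk-single x j =
  subst (j <_) (sym (m∸n+n≡m (≤-trans x≥1 (m≤m+n x 0)))) j<
blk-bound (suc x′ ∷ c′@(y ∷ xs)) (_ ∷ c′≥1) _ j j< with j ≤? x′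
... | yes j≤x′ rewrite FirstPart.blk-firstPart x′ y xs j j≤x′ =
  subst (j <_) (+-comm 1 _) (s≤s (subst (j ≤_) (sym (+-∸-assoc x′ (length≤sum c′ c′≥1))) (≤-trans j≤x′ (m≤m+n x′ _))))
... | no j≰x′ = subst (λ z → blk (suc x′ ∷ c′) z < sum (suc x′ ∷ c′) ∸ length (suc x′ ∷ c′) + 1) j≡ bound
  where
  j′ : ℕ
  j′ = j ∸ suc x′
  j≡ : suc (x′ + j′) ≡ j
  j≡ = m+[n∸m]≡n {suc x′} {j} (≰⇒> j≰x′)
  j′< : j′ < sum c′
  j′< = +-cancelˡ-< (suc x′) j′ (sum c′) (subst (_< suc x′ + sum c′) (sym j≡) j<)
  bound : blk (suc x′ ∷ c′) (suc (x′ + j′)) < (x′ + sum c′) ∸ length c′ + 1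
  bound rewrite FirstPart.blk-rest x′ y xs j′ | +-∸-assoc x′ (length≤sum c′ c′≥1) | +-assoc x′ (sum c′ ∸ length c′) 1 =
    +-monoʳ-< x′ (blk-bound c′ c′≥1 (s≤s z≤n) j′ j′<)

-- A cut strictly inside column t is an inner partial sum: if the
-- positions < m are exactly those in columns < t (below M) and the
-- positions < M lie in columns ≤ t, then every m < p < M is in D.
innerSum-insideColumn : ∀ c t m M p′ → m ≤ p′ → suc p′ < M →
                        (∀ j → j < M → blk c j < t → j < m) → (∀ j → j < M → blk c j < suc t) →
                        suc p′ ∈L innerSums c
innerSum-insideColumn c t m M p′ m≤p′ p<M below-t below-1+t =
  sameColumn⇒innerSum c p′ (≤-antisym (≤-trans col-p≤t t≤col-p′) (blk-step c p′))
  where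
  col-p≤t : blk c (suc p′) ≤ t
  col-p≤t = ≤-pred (below-1+t (suc p′) p<M)
  t≤col-p′ : t ≤ blk c p′
  t≤col-p′ = ≮⇒≥ (λ col< → <⇒≱ (below-t p′ (<-trans (n<1+n p′) p<M) col<) m≤p′)

-- The vertices of σ(β, c): writing prefix p = {y : β⁻¹ y < p}, the
-- chain S₁ ⊂ ⋯ ⊂ S_{k-1} of σ(β, c) is prefix p for p ∈ innerSums c.

module PrefixChain {n : ℕ} (β⁻¹ : Fin n → Fin n) where

  prefix : ℕ → Subset n
  prefix p = tabulate (λ y → toℕ (β⁻¹ y) <ᵇ p)

  prefix-0 : ∅ ≡ prefix 0
  prefix-0 = vec-ext _ _ λ i → trans (lookup-replicate i false) (sym (lookup∘tabulate _ i))

  block : ℕ → ℕ → Subset n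
  block o x = tabulate (λ y → (o ≤ᵇ toℕ (β⁻¹ y)) ∧ (toℕ (β⁻¹ y) <ᵇ (o + x)))

  prefix-∪-block : ∀ o x → (prefix o ∪ block o x) ≡ prefix (o + x)
  prefix-∪-block o x = vec-ext _ _ λ y → begin
      lookup (prefix o ∪ block o x) y
    ≡⟨ lookup-zipWith _∨_ y (prefix o) _ ⟩
      lookup (prefix o) y ∨ lookup (block o x) y
    ≡⟨ cong₂ _∨_ (lookup∘tabulate _ y) (lookup∘tabulate _ y) ⟩
      (toℕ (β⁻¹ y) <ᵇ o) ∨ ((o ≤ᵇ toℕ (β⁻¹ y)) ∧ (toℕ (β⁻¹ y) <ᵇ (o + x)))
    ≡⟨ interval (toℕ (β⁻¹ y)) ⟩
      toℕ (β⁻¹ y) <ᵇ (o + x)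
    ≡⟨ sym (lookup∘tabulate _ y) ⟩
      lookup (prefix (o + x)) y ∎
    where
    open ≡-Reasoning
    interval : ∀ i → ((i <ᵇ o) ∨ ((o ≤ᵇ i) ∧ (i <ᵇ (o + x)))) ≡ (i <ᵇ (o + x))
    interval i with i <? o
    ... | yes i<o rewrite <ᵇ-true i<o | <ᵇ-true {i} {o + x} (≤-trans i<o (m≤m+n o x)) = refl
    ... | no i≮o rewrite <ᵇ-false i≮o | ≤ᵇ-true (≮⇒≥ i≮o) = refl

  chainVerts′⇒prefix : ∀ c o acc v → acc ≡ prefix o → v ∈L chainVerts′ acc (blocksσ β⁻¹ o c) →
                       ∃ λ p → p ∈L innerSums c × v ≡ prefix (o + p)
  chainVerts′⇒prefix (x ∷ y ∷ xs) o acc v refl (here refl) = x , here refl , prefix-∪-block o x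
  chainVerts′⇒prefix (x ∷ y ∷ xs) o acc v refl (there v∈)
    with chainVerts′⇒prefix (y ∷ xs) (o + x) _ v (prefix-∪-block o x) v∈
  ... | p , p∈ , v≡ = x + p , there (∈-map⁺ (x +_) p∈) , trans v≡ (cong prefix (+-assoc o x p))

  prefix⇒chainVerts′ : ∀ c o acc p → acc ≡ prefix o → p ∈L innerSums c →
                       prefix (o + p) ∈L chainVerts′ acc (blocksσ β⁻¹ o c)
  prefix⇒chainVerts′ (x ∷ y ∷ xs) o acc p refl (here refl) = here (sym (prefix-∪-block o x))
  prefix⇒chainVerts′ (x ∷ c@(y ∷ xs)) o acc p refl (there p∈) =
    there (subst (λ z → prefix z ∈L chainVerts′ (prefix o ∪ block o x) (blocksσ β⁻¹ (o + x) c))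
                 (trans (+-assoc o x q) (cong (o +_) q≡))
                 (prefix⇒chainVerts′ c (o + x) _ q (prefix-∪-block o x) q∈))
    where
    q : ℕ
    q = proj₁ (∈-map⁻ (x +_) p∈)
    q∈ : q ∈L innerSums c
    q∈ = proj₁ (proj₂ (∈-map⁻ (x +_) p∈))
    q≡ : x + q ≡ p
    q≡ = sym (proj₂ (proj₂ (∈-map⁻ (x +_) p∈)))

  chainVerts⇒prefix : ∀ c v → v ∈L chainVerts (blocksσ β⁻¹ 0 c) → ∃ λ p → p ∈L innerSums c × v ≡ prefix p
  chainVerts⇒prefix c v v∈ = chainVerts′⇒prefix c 0 ∅ v prefix-0 v∈

  prefix⇒chainVerts : ∀ c p → p ∈L innerSums c → prefix p ∈L chainVerts (blocksσ β⁻¹ 0 c)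
  prefix⇒chainVerts c p p∈ = prefix⇒chainVerts′ c 0 ∅ p prefix-0 p∈

-- Sorting [n] by a key: if x ↦ (k₁ x , k₂ x , x) is ordered
-- lexicographically, the rank of x (the number of elements below it) is
-- a permutation of [n], and every down-set T is sent onto [0, ∣T∣).

injective⇒surjective : ∀ {n} (f : Fin n → Fin n) → (∀ x y → f x ≡ f y → x ≡ y) → ∀ y → ∃ λ x → f x ≡ y
injective⇒surjective {zero} f inj ()
injective⇒surjective {suc m} f inj y with any? (λ x → f x ≟F y)
... | yes hit = hit
... | no miss = ⊥-elim (<-irrefl refl (injective⇒≤ {f = squeeze} squeeze-injective))
  where
  -- f misses y, so it factors through Fin m
  squeeze : Fin (suc m) → Fin m
  squeeze x = punchOut {i = y} {j = f x} (λ eq → miss (x , sym eq))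
  squeeze-injective : ∀ {x x′} → squeeze x ≡ squeeze x′ → x ≡ x′
  squeeze-injective {x} {x′} eq =
    inj x x′ (punchOut-injective (λ e → miss (x , sym e)) (λ e → miss (x′ , sym e)) eq)

Key : Set
Key = ℕ × ℕ × ℕ

_≺ᴷ_ : Key → Key → Set
_≺ᴷ_ = ×-Lex _≡_ _<_ (×-Lex _≡_ _<_ _<_)

module KeyOrder = IsStrictTotalOrder (×-isStrictTotalOrder <-isStrictTotalOrder (×-isStrictTotalOrder <-isStrictTotalOrder <-isStrictTotalOrder))

≺ᴷ-irrefl : ∀ {k} → ¬ (k ≺ᴷ k)
≺ᴷ-irrefl = KeyOrder.irrefl (refl , refl , refl)

module Ranking {n : ℕ} (k₁ k₂ : Fin n → ℕ) where

  -- ties are broken by x itself, so distinct elements are comparable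
  key : Fin n → Key
  key x = k₁ x , k₂ x , toℕ x

  _≺_ : Fin n → Fin n → Set
  x ≺ y = key x ≺ᴷ key y

  below : Fin n → Subset n
  below x = tabulate (λ z → does (key z KeyOrder.<? key x))

  below⁻ : ∀ {z x} → z ∈ below x → z ≺ x
  below⁻ {z} {x} z∈ with key z KeyOrder.<? key x | trans (sym (lookup∘tabulate _ z)) (∈⇒true z∈)
  ... | yes z≺x | _ = z≺x

  below⁺ : ∀ {z x} → z ≺ x → z ∈ below x
  below⁺ {z} {x} z≺x = true⇒∈ (trans (lookup∘tabulate _ z) (decided (key z KeyOrder.<? key x)))
    where
    decided : (d : Dec (z ≺ x)) → does d ≡ true
    decided (yes _) = refl
    decided (no z⊀x) = ⊥-elim (z⊀x z≺x)

  rank : Fin n → ℕ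
  rank x = ∣ below x ∣

  rank-mono : ∀ {x y} → x ≺ y → rank x < rank y
  rank-mono {x} {y} x≺y =
    p⊂q⇒∣p∣<∣q∣ ((λ z∈ → below⁺ (KeyOrder.trans (below⁻ z∈) x≺y)) , x , below⁺ x≺y , λ x∈ → ≺ᴷ-irrefl (below⁻ x∈))

  rank<n : ∀ x → rank x < n
  rank<n x = subst (rank x <_) (∣⊤∣≡n n) (p⊂q⇒∣p∣<∣q∣ ((λ _ → ∈⊤) , x , ∈⊤ , λ x∈ → ≺ᴷ-irrefl (below⁻ x∈)))

  rankF : Fin n → Fin n
  rankF x = fromℕ< (rank<n x)

  toℕ-rankF : ∀ x → toℕ (rankF x) ≡ rank x
  toℕ-rankF x = toℕ-fromℕ< (rank<n x)

  rank-injective : ∀ x y → rank x ≡ rank y → x ≡ y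
  rank-injective x y eq with KeyOrder.compare (key x) (key y)
  ... | tri< x≺y _ _ = ⊥-elim (<-irrefl eq (rank-mono x≺y))
  ... | tri≈ _ (_ , _ , x≡y) _ = toℕ-injective x≡y
  ... | tri> _ _ y≺x = ⊥-elim (<-irrefl (sym eq) (rank-mono y≺x))

  rankF-injective : ∀ x y → rankF x ≡ rankF y → x ≡ y
  rankF-injective x y eq = rank-injective x y (trans (sym (toℕ-rankF x)) (trans (cong toℕ eq) (toℕ-rankF y)))

  γ : Permutation′ n
  γ = permutation (λ y → proj₁ (surj y)) rankF
        (λ x → rankF-injective _ _ (proj₂ (surj (rankF x))))
        (λ y → proj₂ (surj y))
    where surj : ∀ y → ∃ λ x → rankF x ≡ y
          surj = injective⇒surjective rankF rankF-injective

  rankF-γ : ∀ y → rankF (γ ⟨$⟩ʳ y) ≡ y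
  rankF-γ y = inverseˡ γ

  module DownSet (T : Subset n) (down : ∀ x y → x ∈ T → y ∉ T → x ≺ y) where
    rank-∈ : ∀ x → x ∈ T → rank x < ∣ T ∣
    rank-∈ x x∈ = p⊂q⇒∣p∣<∣q∣ (below⊆T , x , x∈ , λ x∈below → ≺ᴷ-irrefl (below⁻ x∈below))
      where
      below⊆T : below x ⊆ T
      below⊆T {z} z∈ with z ∈? T
      ... | yes z∈T = z∈T
      ... | no z∉T = ⊥-elim (≺ᴷ-irrefl (KeyOrder.trans (below⁻ z∈) (down x z x∈ z∉T)))

    rank-∉ : ∀ x → x ∉ T → ∣ T ∣ ≤ rank x
    rank-∉ x x∉ = p⊆q⇒∣p∣≤∣q∣ (λ {z} z∈ → below⁺ (down z x z∈ x∉))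

count : ∀ {W : Set} → (W → Bool) → List W → ℕ
count f [] = 0
count f (w ∷ F) = (if f w then 1 else 0) + count f F

private
  indicator-mono : ∀ {a b : Bool} → (a ≡ true → b ≡ true) → (if a then 1 else 0) ≤ (if b then 1 else 0)
  indicator-mono {false} _ = z≤n
  indicator-mono {true} a⇒b rewrite a⇒b refl = ≤-refl

count-mono : ∀ {W : Set} (f g : W → Bool) F → (∀ w → w ∈L F → f w ≡ true → g w ≡ true) → count f F ≤ count g F
count-mono f g [] _ = z≤n
count-mono f g (w ∷ F) f⇒g = +-mono-≤ (indicator-mono (f⇒g w (here refl))) (count-mono f g F (λ w′ w∈ → f⇒g w′ (there w∈)))

count-strict : ∀ {W : Set} (f g : W → Bool) F → (∀ w → w ∈L F → f w ≡ true → g w ≡ true) →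
               ∀ w₀ → w₀ ∈L F → f w₀ ≡ false → g w₀ ≡ true → count f F < count g F
count-strict f g (w ∷ F) f⇒g w₀ (here refl) fw₀ gw₀ rewrite fw₀ | gw₀ =
  s≤s (count-mono f g F (λ w′ w∈ → f⇒g w′ (there w∈)))
count-strict f g (w ∷ F) f⇒g w₀ (there w₀∈) fw₀ gw₀ =
  +-mono-≤-< (indicator-mono (f⇒g w (here refl))) (count-strict f g F (λ w′ w∈ → f⇒g w′ (there w∈)) w₀ w₀∈ fw₀ gw₀)

-- the maximum of a function on [n] (0 if n = 0), as a least upper bound
maxOver : ∀ {n} → (Fin n → ℕ) → ℕ
maxOver {zero} h = 0
maxOver {suc n} h = h Fin.zero ⊔ maxOver (h ∘ Fin.suc)

maxOver-ub : ∀ {n} (h : Fin n → ℕ) x → h x ≤ maxOver h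
maxOver-ub h Fin.zero = m≤m⊔n _ _
maxOver-ub h (Fin.suc x) = ≤-trans (maxOver-ub (h ∘ Fin.suc) x) (m≤n⊔m _ _)

maxOver-lub : ∀ {n} (h : Fin n → ℕ) b → (∀ x → h x ≤ b) → maxOver h ≤ b
maxOver-lub {zero} h b _ = z≤n
maxOver-lub {suc n} h b h≤b = ⊔-lub (h≤b Fin.zero) (maxOver-lub (h ∘ Fin.suc) b (h≤b ∘ Fin.suc))

module Correspondence (n : ℕ) (c : List ℕ) (0<k : 0 < length c) (c≥1 : All (1 ≤_) c)
                      (sum≡n : sum c ≡ n) (α : Permutation′ n) where

  col : Fin n → ℕ
  col x = blk c (toℕ x)

  column : ℕ → Subset n
  column = Kcol c

  lower : ℕ → Subset n
  lower t = tabulate (λ x → col x <ᵇ t)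

  N : ℕ
  N = n ∸ length c + 1

  ∈column⁻ : ∀ {t x} → x ∈ column t → col x ≡ t
  ∈column⁻ {t} x∈ = ≡ᵇ-sound (∈tabulate⁻ (λ x → col x ≡ᵇ t) x∈)

  ∈column⁺ : ∀ {t x} → col x ≡ t → x ∈ column t
  ∈column⁺ {t} eq = ∈tabulate⁺ (λ x → col x ≡ᵇ t) (≡ᵇ-true eq)

  ∈lower⁻ : ∀ {t x} → x ∈ lower t → col x < t
  ∈lower⁻ {t} x∈ = <ᵇ-sound (∈tabulate⁻ (λ x → col x <ᵇ t) x∈)

  ∈lower⁺ : ∀ {t x} → col x < t → x ∈ lower t
  ∈lower⁺ {t} lt = ∈tabulate⁺ (λ x → col x <ᵇ t) (<ᵇ-true lt)

  blk<N : ∀ j → j < n → blk c j < N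
  blk<N j j<n = subst (λ m → blk c j < m ∸ length c + 1) sum≡n
                      (blk-bound c c≥1 0<k j (subst (j <_) (sym sum≡n) j<n))

  lower-initial : ∀ s j → j < n → (j < ∣ lower s ∣ → blk c j < s) × (blk c j < s → j < ∣ lower s ∣)
  lower-initial s j j<n =
    let (⇒ , ⇐) = initialSegment n (λ i → blk c i <ᵇ s) down j j<n
    in (λ j< → <ᵇ-sound (⇒ j<)) , (λ lt → ⇐ (<ᵇ-true lt))
    where
    down : DownClosed (λ i → blk c i <ᵇ s)
    down i lt = <ᵇ-true (≤-<-trans (blk-step c i) (<ᵇ-sound {blk c (suc i)} {s} lt))

  column-∪-lower : ∀ t → column t ∪ lower t ≡ lower (suc t)
  column-∪-lower t = ⊆-antisym forward backward
    where
    forward : column t ∪ lower t ⊆ lower (suc t)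
    forward x∈ with x∈p∪q⁻ (column t) (lower t) x∈
    ... | inj₁ x∈K = ∈lower⁺ (≤-reflexive (cong suc (∈column⁻ x∈K)))
    ... | inj₂ x∈L = ∈lower⁺ (<-trans (∈lower⁻ x∈L) (n<1+n t))
    backward : lower (suc t) ⊆ column t ∪ lower t
    backward {x} x∈ with m≤n⇒m<n∨m≡n (≤-pred (∈lower⁻ x∈))
    ... | inj₁ lt = x∈p∪q⁺ (inj₂ (∈lower⁺ lt))
    ... | inj₂ eq = x∈p∪q⁺ (inj₁ (∈column⁺ eq))

  pull : Subset n → Subset n
  pull S = tabulate (λ x → lookup S (α ⟨$⟩ʳ x))

  push : Subset n → Subset n
  push T = tabulate (λ y → lookup T (α ⟨$⟩ˡ y))

  pull-push : ∀ T → pull (push T) ≡ T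
  pull-push T = vec-ext _ _ λ x → begin
      lookup (pull (push T)) x          ≡⟨ lookup∘tabulate _ x ⟩
      lookup (push T) (α ⟨$⟩ʳ x)        ≡⟨ lookup∘tabulate _ (α ⟨$⟩ʳ x) ⟩
      lookup T (α ⟨$⟩ˡ (α ⟨$⟩ʳ x))      ≡⟨ cong (lookup T) (inverseˡ α) ⟩
      lookup T x ∎
    where open ≡-Reasoning

  topColumn : Subset n → ℕ
  topColumn T = maxOver (λ x → if lookup T x then col x else 0)

  record EndsIn (T : Subset n) (t : ℕ) : Set where
    field
      bounded : ∀ {x} → x ∈ T → col x ≤ t
      covers  : ∀ {x} → col x < t → x ∈ T
      witness : Fin n
      witness∈ : witness ∈ T
      witness-col : col witness ≡ t

  topColumn-endsIn : ∀ {T t} → EndsIn T t → topColumn T ≡ t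
  topColumn-endsIn {T} {t} e = ≤-antisym (maxOver-lub _ t bound) (subst (_≤ topColumn T) at-witness (maxOver-ub _ witness))
    where
    open EndsIn e
    bound : ∀ x → (if lookup T x then col x else 0) ≤ t
    bound x with lookup T x in x∈
    ... | true = bounded (true⇒∈ x∈)
    ... | false = z≤n
    at-witness : (if lookup T witness then col witness else 0) ≡ t
    at-witness rewrite ∈⇒true witness∈ = witness-col

  split-at-column : ∀ {T t} → EndsIn T t → (T ∩ column t) ∪ lower t ≡ T
  split-at-column {T} {t} e = ⊆-antisym forward backward
    where
    open EndsIn e
    forward : (T ∩ column t) ∪ lower t ⊆ T
    forward {x} x∈ with x∈p∪q⁻ (T ∩ column t) (lower t) x∈
    ... | inj₁ x∈T∩K = proj₁ (x∈p∩q⁻ T (column t) x∈T∩K)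
    ... | inj₂ x∈L = covers (∈lower⁻ x∈L)
    backward : T ⊆ (T ∩ column t) ∪ lower t
    backward {x} x∈ with m≤n⇒m<n∨m≡n (bounded x∈)
    ... | inj₁ lt = x∈p∪q⁺ (inj₂ (∈lower⁺ lt))
    ... | inj₂ eq = x∈p∪q⁺ (inj₁ (x∈p∩q⁺ (x∈ , ∈column⁺ eq)))

  ∪lower-endsIn : ∀ {A t} → A ⊆ column t → Nonempty A → EndsIn (A ∪ lower t) t
  ∪lower-endsIn {A} {t} A⊆K (x₀ , x₀∈) = record
    { bounded = bounded
    ; covers = λ lt → x∈p∪q⁺ (inj₂ (∈lower⁺ lt))
    ; witness = x₀
    ; witness∈ = x∈p∪q⁺ (inj₁ x₀∈)
    ; witness-col = ∈column⁻ (A⊆K x₀∈)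
    }
    where
    bounded : ∀ {x} → x ∈ A ∪ lower t → col x ≤ t
    bounded {x} x∈ with x∈p∪q⁻ A (lower t) x∈
    ... | inj₁ x∈A = ≤-reflexive (∈column⁻ (A⊆K x∈A))
    ... | inj₂ x∈L = <⇒≤ (∈lower⁻ x∈L)

  ∪lower-∩column : ∀ {A t} → A ⊆ column t → (A ∪ lower t) ∩ column t ≡ A
  ∪lower-∩column {A} {t} A⊆K = ⊆-antisym forward (λ x∈A → x∈p∩q⁺ (x∈p∪q⁺ (inj₁ x∈A) , A⊆K x∈A))
    where
    forward : (A ∪ lower t) ∩ column t ⊆ A
    forward x∈ with x∈p∩q⁻ (A ∪ lower t) (column t) x∈
    ... | x∈T , x∈K with x∈p∪q⁻ A (lower t) x∈T
    ... | inj₁ x∈A = x∈A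
    ... | inj₂ x∈L = ⊥-elim (<-irrefl (∈column⁻ x∈K) (∈lower⁻ x∈L))

  φ : Subset n → ℕ × Subset n
  φ S = topColumn (pull S) , pull S ∩ column (topColumn (pull S))

  ψ : ℕ × Subset n → Subset n
  ψ (t , A) = push (A ∪ lower t)

  φ-push : ∀ {T t} → EndsIn T t → φ (push T) ≡ (t , T ∩ column t)
  φ-push {T} e rewrite pull-push T | topColumn-endsIn e = refl

  ψ-φ-push : ∀ {T t} → EndsIn T t → ψ (φ (push T)) ≡ push T
  ψ-φ-push e = trans (cong ψ (φ-push e)) (cong push (split-at-column e))

  φ-ψ : ∀ {t A} → A ⊆ column t → Nonempty A → φ (ψ (t , A)) ≡ (t , A)
  φ-ψ {t} A⊆K ne = trans (φ-push (∪lower-endsIn A⊆K ne)) (cong (t ,_) (∪lower-∩column A⊆K))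

  FlatColumns : Complex
  FlatColumns = FlatJoin N column

  module Facet (γ : Permutation′ n) (γ-col : InColGroup c γ) where

    place : Fin n → ℕ
    place x = toℕ (γ ⟨$⟩ˡ x)

    col-place : ∀ x → col x ≡ blk c (place x)
    col-place x = trans (cong col (sym (inverseʳ γ))) (γ-col (γ ⟨$⟩ˡ x))

    initial : ℕ → Subset n
    initial p = tabulate (λ x → place x <ᵇ p)

    ∈initial⁻ : ∀ {p x} → x ∈ initial p → place x < p
    ∈initial⁻ {p} {x} x∈ = <ᵇ-sound {place x} {p} (∈tabulate⁻ (λ x → place x <ᵇ p) x∈)

    ∈initial⁺ : ∀ {p x} → place x < p → x ∈ initial p
    ∈initial⁺ {p} lt = ∈tabulate⁺ (λ x → place x <ᵇ p) (<ᵇ-true lt)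

    initial-mono : ∀ {p q} → p ≤ q → initial p ⊆ initial q
    initial-mono p≤q x∈ = ∈initial⁺ (<-≤-trans (∈initial⁻ x∈) p≤q)

    chain-vertex : ∀ S → S ∈L chainVerts (σαγ c α γ) → ∃ λ p′ → suc p′ ∈L innerSums c × S ≡ push (initial (suc p′))
    chain-vertex S S∈ with PrefixChain.chainVerts⇒prefix (λ y → γ ⟨$⟩ˡ (α ⟨$⟩ˡ y)) c S S∈
    ... | p , p∈ , refl with innerSum-bounds c p c≥1 p∈
    ... | s≤s z≤n , _ = _ , p∈ , vec-ext _ _ λ y →
            trans (lookup∘tabulate _ y) (sym (trans (lookup∘tabulate _ y) (lookup∘tabulate _ (α ⟨$⟩ˡ y))))

    module AtInnerSum (p′ : ℕ) (p∈ : suc p′ ∈L innerSums c) where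

      p<n : suc p′ < n
      p<n = subst (suc p′ <_) sum≡n (proj₂ (innerSum-bounds c (suc p′) c≥1 p∈))

      t : ℕ
      t = blk c (suc p′)

      last next : Fin n
      last = γ ⟨$⟩ʳ fromℕ< (<-trans (n<1+n p′) p<n)
      next = γ ⟨$⟩ʳ fromℕ< p<n

      place-last : place last ≡ p′
      place-last = trans (cong toℕ (inverseˡ γ)) (toℕ-fromℕ< _)

      place-next : place next ≡ suc p′
      place-next = trans (cong toℕ (inverseˡ γ)) (toℕ-fromℕ< _)

      endsIn : EndsIn (initial (suc p′)) t
      endsIn = record
        { bounded = λ {x} x∈ → subst (_≤ t) (sym (col-place x))
                      (subst (blk c (place x) ≤_) (sym same) (blk-mono c (≤-pred (∈initial⁻ x∈))))
        ; covers = covers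
        ; witness = last
        ; witness∈ = ∈initial⁺ (s≤s (≤-reflexive place-last))
        ; witness-col = trans (col-place last) (trans (cong (blk c) place-last) (sym same))
        }
        where
        same : blk c (suc p′) ≡ blk c p′
        same = innerSum⇒sameColumn c p′ p∈
        covers : ∀ {x} → col x < t → x ∈ initial (suc p′)
        covers {x} lt with place x <? suc p′
        ... | yes x< = ∈initial⁺ x<
        ... | no x≮ = ⊥-elim (<⇒≱ lt (subst (t ≤_) (sym (col-place x)) (blk-mono c (≮⇒≥ x≮))))

      proper : initial (suc p′) ∩ column t ⊂ column t
      proper = (λ x∈ → proj₂ (x∈p∩q⁻ _ _ x∈)) ,
               next , ∈column⁺ (trans (col-place next) (cong (blk c) place-next)) ,
               (λ next∈ → <-irrefl place-next (∈initial⁻ (proj₁ (x∈p∩q⁻ _ _ next∈))))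

    φ-vertex : ∀ S → S ∈L chainVerts (σαγ c α γ) →
               ∃ λ p′ → Σ (suc p′ ∈L innerSums c) λ p∈ → φ S ≡ (AtInnerSum.t p′ p∈ , initial (suc p′) ∩ column (AtInnerSum.t p′ p∈))
    φ-vertex S S∈ with chain-vertex S S∈
    ... | p′ , p∈ , refl = p′ , p∈ , φ-push (AtInnerSum.endsIn p′ p∈)

  -- φ maps faces of Σ_α to flat faces: the vertices of one facet in a
  -- common column are nested since the sets initial p increase with p.
  φ-face : ∀ F → Face (Sigma c α) F → Face FlatColumns (map φ F)
  φ-face F (γ , γ-col , F⊆facet) = vertex , nested
    where
    open Facet γ γ-col
    vertex : ∀ w → w ∈L map φ F → proj₁ w < N × Nonempty (proj₂ w) × proj₂ w ⊂ column (proj₁ w)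
    vertex w w∈ with ∈-map⁻ φ w∈
    ... | S , S∈ , refl with φ-vertex S (F⊆facet S S∈)
    ... | p′ , p∈ , φS≡ = subst (λ w → proj₁ w < N × Nonempty (proj₂ w) × proj₂ w ⊂ column (proj₁ w)) (sym φS≡)
                            (blk<N (suc p′) p<n , (witness , x∈p∩q⁺ (witness∈ , ∈column⁺ witness-col)) , proper)
      where open AtInnerSum p′ p∈
            open EndsIn endsIn
    nested : ∀ w w′ → w ∈L map φ F → w′ ∈L map φ F → proj₁ w ≡ proj₁ w′ → Comparable (proj₂ w) (proj₂ w′)
    nested w w′ w∈ w′∈ t≡ with ∈-map⁻ φ w∈ | ∈-map⁻ φ w′∈
    ... | S , S∈ , refl | S′ , S′∈ , refl with φ-vertex S (F⊆facet S S∈) | φ-vertex S′ (F⊆facet S′ S′∈)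
    ... | p′ , p∈ , φS≡ | q′ , q∈ , φS′≡ =
      subst₂ Comparable (sym (cong proj₂ φS≡)) (sym (cong proj₂ φS′≡))
             (comparable (trans (sym (cong proj₁ φS≡)) (trans t≡ (cong proj₁ φS′≡))))
      where
      t₁ t₂ : ℕ
      t₁ = AtInnerSum.t p′ p∈
      t₂ = AtInnerSum.t q′ q∈
      comparable : t₁ ≡ t₂ → Comparable (initial (suc p′) ∩ column t₁) (initial (suc q′) ∩ column t₂)
      comparable t₁≡t₂ rewrite t₁≡t₂ with ≤-total (suc p′) (suc q′)
      ... | inj₁ p≤q = inj₁ (∩-monoˡ (initial-mono p≤q))
      ... | inj₂ q≤p = inj₂ (∩-monoˡ (initial-mono q≤p))

  ψ-φ : ∀ S → Face (Sigma c α) (S ∷ []) → ψ (φ S) ≡ S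
  ψ-φ S (γ , γ-col , S⊆facet) with Facet.chain-vertex γ γ-col S (S⊆facet S (here refl))
  ... | p′ , p∈ , refl = ψ-φ-push (Facet.AtInnerSum.endsIn γ γ-col p′ p∈)

  -- Conversely, a flat face G lies in the facet σ(α∘γ, c) where γ sorts
  -- the positions by column, then by the number of vertices of G in their
  -- column missing them.  Then each A ∪ lower t, (t , A) ∈ G, is a
  -- down-set for this order, hence an initial set of γ.
  module FromFlatFace (G : List (ℕ × Subset n)) (G-face : Face FlatColumns G) where

    missing : Fin n → ℕ
    missing x = count (λ w → (proj₁ w ≡ᵇ col x) ∧ not (lookup (proj₂ w) x)) G

    open Ranking col missing

    lower-down : ∀ s x y → x ∈ lower s → y ∉ lower s → x ≺ y
    lower-down s x y x∈ y∉ = inj₁ (<-≤-trans (∈lower⁻ {s} x∈) (≮⇒≥ (y∉ ∘ ∈lower⁺ {s})))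

    rank-lower : ∀ s x → (rank x < ∣ lower s ∣ → col x < s) × (col x < s → rank x < ∣ lower s ∣)
    rank-lower s x = (λ r< → ≮⇒≥-contra r<) , (λ lt → rank-∈ x (∈lower⁺ lt))
      where
      open DownSet (lower s) (lower-down s)
      ≮⇒≥-contra : rank x < ∣ lower s ∣ → col x < s
      ≮⇒≥-contra r< with col x <? s
      ... | yes lt = lt
      ... | no col≮ = ⊥-elim (<⇒≱ r< (rank-∉ x (col≮ ∘ ∈lower⁻)))

    blk-rank : ∀ x → blk c (rank x) ≡ col x
    blk-rank x = same-upperBounds⇒≡
      (λ s lt → proj₁ (rank-lower s x) (proj₂ (lower-initial s (rank x) (rank<n x)) lt))
      (λ s lt → proj₁ (lower-initial s (rank x) (rank<n x)) (proj₂ (rank-lower s x) lt))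

    γ-col : InColGroup c γ
    γ-col j = sym (begin
        blk c (toℕ j)                 ≡⟨ cong (blk c ∘ toℕ) (sym (rankF-γ j)) ⟩
        blk c (toℕ (rankF (γ ⟨$⟩ʳ j))) ≡⟨ cong (blk c) (toℕ-rankF (γ ⟨$⟩ʳ j)) ⟩
        blk c (rank (γ ⟨$⟩ʳ j))       ≡⟨ blk-rank (γ ⟨$⟩ʳ j) ⟩
        col (γ ⟨$⟩ʳ j) ∎)
      where open ≡-Reasoning

    module AtVertex (t : ℕ) (A : Subset n) (w∈ : (t , A) ∈L G) where

      A⊂K : A ⊂ column t
      A⊂K = proj₂ (proj₂ (proj₁ G-face (t , A) w∈))

      A-nonempty : Nonempty A
      A-nonempty = proj₁ (proj₂ (proj₁ G-face (t , A) w∈))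

      cut : Subset n
      cut = A ∪ lower t

      missing-< : ∀ x y → x ∈ A → y ∉ A → col y ≡ t → missing x < missing y
      missing-< x y x∈A y∉A col-y = count-strict (misses x) (misses y) G x⇒y (t , A) w∈ A-has-x A-misses-y
        where
        misses : Fin n → ℕ × Subset n → Bool
        misses z w = (proj₁ w ≡ᵇ col z) ∧ not (lookup (proj₂ w) z)
        col-x : col x ≡ t
        col-x = ∈column⁻ (proj₁ A⊂K x∈A)
        -- a vertex (t , A′) of G missing x is comparable with A ∋ x, so A′ ⊆ A
        x⇒y : ∀ w → w ∈L G → misses x w ≡ true → misses y w ≡ true
        x⇒y (t′ , A′) w′∈ e with ∧-true e
        ... | t′≡ , x∉A′ with proj₂ G-face (t , A) (t′ , A′) w∈ w′∈ (trans (sym col-x) (sym (≡ᵇ-sound {t′} t′≡)))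
        ... | inj₁ A⊆A′ = ⊥-elim (not-true x∉A′ (∈⇒true (A⊆A′ x∈A)))
        ... | inj₂ A′⊆A = cong₂ _∧_ (≡ᵇ-true (trans (≡ᵇ-sound {t′} t′≡) (trans col-x (sym col-y))))
                                    (cong not (∉⇒false {S = A′} (y∉A ∘ A′⊆A)))
        A-has-x : misses x (t , A) ≡ false
        A-has-x rewrite ∈⇒true x∈A = ∧-zeroʳ _
        A-misses-y : misses y (t , A) ≡ true
        A-misses-y = cong₂ _∧_ (≡ᵇ-true (sym col-y)) (cong not (∉⇒false y∉A))

      cut-down : ∀ x y → x ∈ cut → y ∉ cut → x ≺ y
      cut-down x y x∈ y∉ with x∈p∪q⁻ A (lower t) x∈
      ... | inj₂ x∈L = inj₁ (<-≤-trans (∈lower⁻ {t} x∈L) (≮⇒≥ (λ lt → y∉ (x∈p∪q⁺ (inj₂ (∈lower⁺ lt))))))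
      ... | inj₁ x∈A with <-cmp t (col y)
      ...   | tri< t< _ _ = inj₁ (subst (_< col y) (sym (∈column⁻ (proj₁ A⊂K x∈A))) t<)
      ...   | tri≈ _ t≡ _ = inj₂ (trans (∈column⁻ (proj₁ A⊂K x∈A)) t≡ ,
                                  inj₁ (missing-< x y x∈A (λ y∈A → y∉ (x∈p∪q⁺ (inj₁ y∈A))) (sym t≡)))
      ...   | tri> _ _ t> = ⊥-elim (y∉ (x∈p∪q⁺ (inj₂ (∈lower⁺ t>))))

      -- ∣ cut ∣ = ∣ A ∣ + ∣ lower t ∣ cuts column t strictly inside, so it is in D
      cut∈D : ∣ cut ∣ ∈L innerSums c
      cut∈D = subst (_∈L innerSums c) (sym (∣∪∣-disjoint A (lower t) (λ x∈A x∈L → apart (proj₁ A⊂K x∈A) x∈L)))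
                    (inside ∣ A ∣ 1≤∣A∣ (p⊂q⇒∣p∣<∣q∣ A⊂K))
        where
        apart : ∀ {x} → x ∈ column t → x ∉ lower t
        apart x∈K x∈L = <-irrefl (∈column⁻ x∈K) (∈lower⁻ x∈L)
        1≤∣A∣ : 1 ≤ ∣ A ∣
        1≤∣A∣ = subst (_< ∣ A ∣) (∣⊥∣≡0 n) (p⊂q⇒∣p∣<∣q∣ ((λ x∈∅ → ⊥-elim (∉⊥ x∈∅)) , proj₁ A-nonempty , proj₂ A-nonempty , ∉⊥))
        ∣K∣+∣L∣ : ∣ column t ∣ + ∣ lower t ∣ ≡ ∣ lower (suc t) ∣
        ∣K∣+∣L∣ = trans (sym (∣∪∣-disjoint (column t) (lower t) apart)) (cong ∣_∣ (column-∪-lower t))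
        inside : ∀ a → 1 ≤ a → a < ∣ column t ∣ → a + ∣ lower t ∣ ∈L innerSums c
        inside (suc a′) _ a<K =
          innerSum-insideColumn c t ∣ lower t ∣ ∣ lower (suc t) ∣ (a′ + ∣ lower t ∣) (m≤n+m _ a′)
            (subst (suc a′ + ∣ lower t ∣ <_) ∣K∣+∣L∣ (+-monoˡ-< ∣ lower t ∣ a<K))
            (λ j j<M lt → proj₂ (lower-initial t j (<-≤-trans j<M (∣p∣≤n (lower (suc t))))) lt)
            (λ j j<M → proj₁ (lower-initial (suc t) j (<-≤-trans j<M (∣p∣≤n (lower (suc t))))) j<M)

      ψ-initial : ψ (t , A) ≡ PrefixChain.prefix (λ y → γ ⟨$⟩ˡ (α ⟨$⟩ˡ y)) ∣ cut ∣
      ψ-initial = vec-ext _ _ λ y → begin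
          lookup (push cut) y                     ≡⟨ lookup∘tabulate _ y ⟩
          lookup cut (α ⟨$⟩ˡ y)                   ≡⟨ rank-test (α ⟨$⟩ˡ y) ⟩
          rank (α ⟨$⟩ˡ y) <ᵇ ∣ cut ∣               ≡⟨ cong (_<ᵇ ∣ cut ∣) (sym (toℕ-rankF (α ⟨$⟩ˡ y))) ⟩
          toℕ (rankF (α ⟨$⟩ˡ y)) <ᵇ ∣ cut ∣        ≡⟨ sym (lookup∘tabulate _ y) ⟩
          lookup (PrefixChain.prefix (λ y → γ ⟨$⟩ˡ (α ⟨$⟩ˡ y)) ∣ cut ∣) y ∎
        where
        open ≡-Reasoning
        open DownSet cut cut-down
        rank-test : ∀ x → lookup cut x ≡ (rank x <ᵇ ∣ cut ∣)
        rank-test x with x ∈? cut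
        ... | yes x∈ = trans (∈⇒true x∈) (sym (<ᵇ-true (rank-∈ x x∈)))
        ... | no x∉ = trans (∉⇒false x∉) (sym (<ᵇ-false (λ lt → <⇒≱ lt (rank-∉ x x∉))))

      ψ-chain : ψ (t , A) ∈L chainVerts (σαγ c α γ)
      ψ-chain = subst (_∈L chainVerts (σαγ c α γ)) (sym ψ-initial)
                      (PrefixChain.prefix⇒chainVerts (λ y → γ ⟨$⟩ˡ (α ⟨$⟩ˡ y)) c ∣ cut ∣ cut∈D)

    ψ-face : Face (Sigma c α) (map ψ G)
    ψ-face = γ , γ-col , λ v v∈ → vertex v (∈-map⁻ ψ v∈)
      where
      vertex : ∀ v → ∃ (λ w → w ∈L G × v ≡ ψ w) → v ∈L chainVerts (σαγ c α γ)
      vertex v ((t , A) , w∈ , refl) = AtVertex.ψ-chain t A w∈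

  Σ≅flat : Iso (Sigma c α) FlatColumns
  Σ≅flat =
    φ , ψ , φ-face , FromFlatFace.ψ-face , ψ-φ ,
    (λ { (t , A) w → let (_ , ne , A⊂K) = proj₁ w (t , A) (here refl) in φ-ψ (proj₁ A⊂K) ne })

lemma6p1 : (n : ℕ) (c : List ℕ) → 0 < length c → All (λ x → 1 ≤ x) c → sum c ≡ n →
    (α : Permutation′ n) → Iso (Sigma c α) (Join (map P (columnIntervals n c)))
lemma6p1 n c 0<k c≥1 sum≡n α =
  Iso-trans Σ≅flat (flat≅join-tabulate N column (subst (0 <_) (+-comm 1 (n ∸ length c)) (s≤s z≤n)))
  where open Correspondence n c 0<k c≥1 sum≡n α
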